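{- Let $n\geq 3$, $\vec{x}\in\mathbb{Z}^n$ and $m\in\{1,\ldots,n-1\}$. If $\vec{x}(m)=\vec{x}(m+1)$, $k(\vec{x})\geq m-1$ and $l(\vec{x})\geq m-2$, then $f(\vec{x})=\vec{x}(m)$.
   Context: For $\vec{x}\in\mathbb{Z}^n$ write $\vec{x}(i)$ for its $i$-th entry. $k(\vec{x})=n$ if $\vec{x}(1)>\cdots>\vec{x}(n)$, otherwise the least $k$ with $\vec{x}(k)\leq\vec{x}(k+1)$. $l(\vec{x})$ is the least $l$ with $1\leq l<k(\vec{x})$, $\vec{x}(l)>\vec{x}(l+1)+1$ and $\vec{x}(l+1)=\vec{x}(l+2)+1$ if it exists, otherwise $k(\vec{x})-1$. The function $f:\mathbb{Z}^n\to\mathbb{Z}$ (Bailey–Cowles) is given by: $f(\vec{x})=\vec{x}(1)$ if $k(\vec{x})=n$, and $f(\vec{x})=\max\{\vec{x}(l(\vec{x})+2),\vec{x}(k(\vec{x})+1)\}$ if $k(\vec{x})<n$. -}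

module Defs where

open import Data.Nat using (ℕ; zero; suc; _∸_; _≤ᵇ_) renaming (_≟_ to _≟ℕ_)
open import Data.Integer using (ℤ; +_; _⊔_) renaming (_+_ to _+ℤ_; _≤?_ to _≤ℤ?_; _<?_ to _<ℤ?_; _≟_ to _≟ℤ_)
open import Data.Vec using (Vec; []; _∷_)
open import Data.Maybe using (Maybe; just; nothing; fromMaybe)
open import Data.Bool using (Bool; true; false; if_then_else_; _∧_)
open import Relation.Nullary.Decidable using (⌊_⌋)

-- 1-indexed entry x(i) of a vector; only ever used for 1 ≤ i ≤ n
-- (the value 0 outside this range is junk and never consulted below).
at : ∀ {n} → Vec ℤ n → ℕ → ℤ
at []       _             = + 0
at (a ∷ xs) zero          = + 0
at (a ∷ xs) (suc zero)    = a
at (a ∷ xs) (suc (suc i)) = at xs (suc i)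

firstFrom : (ℕ → Bool) → ℕ → ℕ → Maybe ℕ
firstFrom P i zero    = nothing
firstFrom P i (suc c) = if P i then just i else firstFrom P (suc i) c

kfun : ∀ {n} → Vec ℤ n → ℕ
kfun {n} x = fromMaybe n (firstFrom (λ j → ⌊ at x j ≤ℤ? at x (suc j) ⌋) 1 (n ∸ 1))

lcond : ∀ {n} → Vec ℤ n → ℕ → Bool
lcond {n} x j = (suc (suc j) ≤ᵇ n)
              ∧ ⌊ (at x (suc j) +ℤ + 1) <ℤ? at x j ⌋
              ∧ ⌊ at x (suc j) ≟ℤ (at x (suc (suc j)) +ℤ + 1) ⌋

lfun : ∀ {n} → Vec ℤ n → ℕ
lfun x = fromMaybe (kfun x ∸ 1) (firstFrom (lcond x) 1 (kfun x ∸ 1))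

f : ∀ {n} → Vec ℤ n → ℤ
f {n} x = if ⌊ kfun x ≟ℕ n ⌋ then at x 1 else (at x (suc (suc (lfun x))) ⊔ at x (suc (kfun x)))

-- Since x(m) ≤ x(m+1), the first ascent satisfies k(x) ≤ m, and l(x) ≤ k(x) − 1 always.
-- Together with the hypotheses this pins both indices used by f, namely l(x)+2 and
-- k(x)+1, to the plateau {m, m+1}; moreover k(x) ≤ m < n, so f is the maximum of
-- two entries both equal to x(m).
module Submission where

open import Defs
open import Data.Nat using (ℕ; zero; suc; _≤_; _<_; _∸_; _+_; z≤n; s≤s) renaming (_≟_ to _≟ℕ_)
open import Data.Nat.Properties
  using (≤-refl; ≤-trans; ≤-reflexive; ≤-antisym; ≤-<-trans; <-irrefl; <⇒≤; <⇒≤pred;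
         ≤∧≢⇒<; m≤n+m∸n; m+[n∸m]≡n; +-monoʳ-≤; m<m+n; +-suc; +-identityʳ)
open import Data.Integer as ℤ using (ℤ; _⊔_)
import Data.Integer.Properties as ℤ
open import Data.Vec using (Vec)
open import Data.Maybe using (just; nothing)
open import Data.Bool using (true; false; T; if_then_else_)
open import Data.Product using (_×_; _,_; ∃; proj₁; proj₂)
open import Data.Empty using (⊥-elim)
open import Relation.Nullary using (yes; no)
open import Relation.Nullary.Decidable using (⌊_⌋; fromWitness)
open import Relation.Binary.PropositionalEquality using (_≡_; _≢_; refl; sym; cong₂; module ≡-Reasoning)

firstFrom-range : ∀ P i c {j} → firstFrom P i c ≡ just j → i ≤ j × j < i + c
firstFrom-range P i (suc c) eq with P i
firstFrom-range P i (suc c) refl | true  = ≤-refl , m<m+n i (s≤s z≤n)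
firstFrom-range P i (suc c) eq   | false with firstFrom-range P (suc i) c eq
... | i<j , j<i+1+c = <⇒≤ i<j , ≤-trans j<i+1+c (≤-reflexive (sym (+-suc i c)))

firstFrom-least : ∀ P i c {j} → i ≤ j → j < i + c → T (P j) →
                  ∃ λ r → firstFrom P i c ≡ just r × r ≤ j
firstFrom-least P i zero i≤j j<i+0 _ =
  ⊥-elim (<-irrefl refl (≤-trans j<i+0 (≤-trans (≤-reflexive (+-identityʳ i)) i≤j)))
firstFrom-least P i (suc c) {j} i≤j j<i+1+c Pj with i ≟ℕ j
... | yes refl with P i
...   | true  = i , refl , ≤-refl
...   | false = ⊥-elim Pj
firstFrom-least P i (suc c) {j} i≤j j<i+1+c Pj | no i≢j with P i
... | true  = i , refl , i≤j
... | false = firstFrom-least P (suc i) c (≤∧≢⇒< i≤j i≢j)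
                (≤-trans j<i+1+c (≤-reflexive (+-suc i c))) Pj

kfun-≤ : ∀ {n} (x : Vec ℤ n) {j} → 1 ≤ j → j < n → at x j ℤ.≤ at x (suc j) → kfun x ≤ j
kfun-≤ {suc n} x 1≤j j<n xj≤xj+1
  with firstFrom-least (λ i → ⌊ at x i ℤ.≤? at x (suc i) ⌋) 1 n 1≤j j<n (fromWitness xj≤xj+1)
... | r , eq , r≤j rewrite eq = r≤j

kfun-positive : ∀ {n} (x : Vec ℤ n) → 1 ≤ n → 1 ≤ kfun x
kfun-positive {suc n} x _ with firstFrom (λ i → ⌊ at x i ℤ.≤? at x (suc i) ⌋) 1 n in eq
... | nothing = s≤s z≤n
... | just r  = proj₁ (firstFrom-range _ 1 n eq)

lfun≤kfun∸1 : ∀ {n} (x : Vec ℤ n) → lfun x ≤ kfun x ∸ 1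
lfun≤kfun∸1 x with firstFrom (lcond x) 1 (kfun x ∸ 1) in eq
... | nothing = ≤-refl
... | just r  = <⇒≤pred (proj₂ (firstFrom-range (lcond x) 1 (kfun x ∸ 1) eq))

lfun<kfun : ∀ {n} (x : Vec ℤ n) → 1 ≤ n → lfun x < kfun x
lfun<kfun x 1≤n = ≤-trans (s≤s (lfun≤kfun∸1 x)) (≤-reflexive (m+[n∸m]≡n (kfun-positive x 1≤n)))

f-ascending : ∀ {n} (x : Vec ℤ n) → kfun x ≢ n →
              f x ≡ at x (suc (suc (lfun x))) ⊔ at x (suc (kfun x))
f-ascending {n} x = if-≟-≢ (kfun x) n
  where
  if-≟-≢ : ∀ {a b : ℤ} i j → i ≢ j → (if ⌊ i ≟ℕ j ⌋ then a else b) ≡ b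
  if-≟-≢ i j i≢j with i ≟ℕ j
  ... | yes i≡j = ⊥-elim (i≢j i≡j)
  ... | no _    = refl

at-plateau : ∀ {n} (x : Vec ℤ n) {m j} → at x m ≡ at x (suc m) →
             m ≤ j → j ≤ suc m → at x j ≡ at x m
at-plateau x {m} {j} xm≡xm+1 m≤j j≤m+1 with m ≟ℕ j
... | yes refl = refl
... | no m≢j rewrite ≤-antisym j≤m+1 (≤∧≢⇒< m≤j m≢j) = sym xm≡xm+1

lemma3p7 : (n : ℕ) → 3 ≤ n → (x : Vec ℤ n) → (m : ℕ) → 1 ≤ m → m ≤ n ∸ 1
         → at x m ≡ at x (suc m) → m ∸ 1 ≤ kfun x → m ∸ 2 ≤ lfun x
         → f x ≡ at x m
lemma3p7 n 3≤n x m 1≤m m≤n∸1 xm≡xm+1 m∸1≤k m∸2≤l = begin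
  f x                                             ≡⟨ f-ascending x (λ k≡n → <-irrefl k≡n k<n) ⟩
  at x (suc (suc (lfun x))) ⊔ at x (suc (kfun x)) ≡⟨ cong₂ _⊔_ (on-plateau l+2≥m l+2≤m+1)
                                                               (on-plateau k+1≥m (s≤s k≤m)) ⟩
  at x m ⊔ at x m                                 ≡⟨ ℤ.⊔-idem (at x m) ⟩
  at x m                                          ∎
  where
  open ≡-Reasoning
  on-plateau : ∀ {j} → m ≤ j → j ≤ suc m → at x j ≡ at x m
  on-plateau = at-plateau x xm≡xm+1
  1≤n : 1 ≤ n
  1≤n = ≤-trans (s≤s z≤n) 3≤n
  m<n : m < n
  m<n = ≤-trans (s≤s m≤n∸1) (≤-reflexive (m+[n∸m]≡n 1≤n))
  k≤m : kfun x ≤ m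
  k≤m = kfun-≤ x 1≤m m<n (ℤ.≤-reflexive xm≡xm+1)
  k<n : kfun x < n
  k<n = ≤-<-trans k≤m m<n
  l+2≥m : m ≤ suc (suc (lfun x))
  l+2≥m = ≤-trans (m≤n+m∸n m 2) (+-monoʳ-≤ 2 m∸2≤l)
  l+2≤m+1 : suc (suc (lfun x)) ≤ suc m
  l+2≤m+1 = s≤s (≤-trans (lfun<kfun x 1≤n) k≤m)
  k+1≥m : m ≤ suc (kfun x)
  k+1≥m = ≤-trans (m≤n+m∸n m 1) (+-monoʳ-≤ 1 m∸1≤k)
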